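{- Let $A=\{a,b\}$. Then $\mathit{MinPal}(A^{\mathbb N}_{\mathrm{cl}})=\mathit{MinPal}(A^{\mathbb N}_{\mathrm{ab/cl}})$, where $A^{\mathbb N}_{\mathrm{cl}}$ is the set of infinite words over $A$ closed under reversal and $A^{\mathbb N}_{\mathrm{ab/cl}}$ the set of aperiodic infinite words over $A$ closed under reversal.
   Context: $\mathit{MinPal}(X)=\inf\{\#\mathrm{PAL}(\omega)\mid\omega\in X\}$, where $\mathrm{PAL}(\omega)$ is the set of palindromic factors of $\omega$ including the empty word. Closed under reversal: the reversal of every factor is a factor. Aperiodic: not ultimately periodic. -}

module Defs where

open import Data.Nat using (ℕ; zero; suc; _+_; _≤_; _<_)
open import Data.List using (List; []; _∷_; length; reverse)
open import Data.List.Membership.Propositional using (_∈_)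
open import Data.Product using (Σ; _×_; ∃; ∃-syntax)
open import Relation.Binary.PropositionalEquality using (_≡_)
open import Relation.Nullary using (¬_)

data A : Set where
  a b : A

InfWord : Set
InfWord = ℕ → A

Word : Set
Word = List A

slice : InfWord → ℕ → ℕ → Word
slice ω i zero    = []
slice ω i (suc k) = ω i ∷ slice ω (suc i) k

Factor : Word → InfWord → Set
Factor w ω = ∃[ i ] slice ω i (length w) ≡ w

Palindrome : Word → Set
Palindrome w = reverse w ≡ w

PAL : InfWord → Word → Set
PAL ω w = Factor w ω × Palindrome w

-- #PAL(ω) ≤ n : all palindromic factors of ω lie in a list of length ≤ n.
PalCountLe : InfWord → ℕ → Set
PalCountLe ω n = Σ (List Word) λ L → length L ≤ n × (∀ w → PAL ω w → w ∈ L)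

ClosedUnderReversal : InfWord → Set
ClosedUnderReversal ω = ∀ w → Factor w ω → Factor (reverse w) ω

UltimatelyPeriodic : InfWord → Set
UltimatelyPeriodic ω = ∃[ p ] (0 < p × ∃[ N ] (∀ i → N ≤ i → ω (i + p) ≡ ω i))

Aperiodic : InfWord → Set
Aperiodic ω = ¬ UltimatelyPeriodic ω

Cl : InfWord → Set
Cl ω = ClosedUnderReversal ω

AbCl : InfWord → Set
AbCl ω = Aperiodic ω × ClosedUnderReversal ω

-- MinPal(X) ≤ n   (MinPal takes values in ℕ ∪ {∞}; the infimum over a
-- well-order is attained, so MinPal(X) ≤ n iff some ω ∈ X has #PAL(ω) ≤ n).
MinPalLe : (InfWord → Set) → ℕ → Set
MinPalLe X n = ∃[ ω ] (X ω × PalCountLe ω n)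

-- If ω is ultimately periodic with period p from N on and closed under reversal,
-- then the reversal of a long factor starting at N occurs at some position i.
-- Since ω is periodic there, i may be moved to within p of N; the overlap of the
-- factor with its mirrored copy then reads the same in both directions, giving
-- palindromic factors of every length.  A word with finitely many palindromic
-- factors therefore cannot be ultimately periodic, so the two minima agree.
module Submission where

open import Defs
open import Data.Nat using (ℕ)
open import Function.Bundles using (_⇔_; mk⇔)

open import Data.Nat using (zero; suc; _+_; _*_; _∸_; _≤_; NonZero; >-nonZero)
open import Data.Nat.Properties
  using (+-identityʳ; +-suc; suc-injective; ≤-trans; m≤m+n; m≤n+m; <⇒≤; <⇒≱; m+[n∸m]≡n)
open import Data.Nat.DivMod using (_%_; _/_; m≡m%n+[m/n]*n; m%n<n)
open import Data.Nat.Tactic.RingSolver using (solve-∀)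
open import Data.List using ([]; _∷_; _∷ʳ_; length; reverse; map)
open import Data.List.Properties using (∷-injective; reverse-++; length-reverse)
open import Data.List.Extrema.Nat using (max; xs≤max)
open import Data.List.Relation.Unary.All as All using ()
open import Data.List.Membership.Propositional.Properties using (∈-map⁺)
open import Data.Product using (_×_; _,_; ∃-syntax)
open import Relation.Binary.PropositionalEquality

slice-∷ʳ : ∀ (f : InfWord) i k → slice f i (suc k) ≡ slice f i k ∷ʳ f (i + k)
slice-∷ʳ f i zero    = cong (λ j → f j ∷ []) (sym (+-identityʳ i))
slice-∷ʳ f i (suc k) = cong (f i ∷_) (begin
  slice f (suc i) (suc k)           ≡⟨ slice-∷ʳ f (suc i) k ⟩
  slice f (suc i) k ∷ʳ f (suc i + k) ≡⟨ cong (λ j → slice f (suc i) k ∷ʳ f j) (sym (+-suc i k)) ⟩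
  slice f (suc i) k ∷ʳ f (i + suc k) ∎)
  where open ≡-Reasoning

reverse-slice-suc : ∀ (f : InfWord) i k →
                    reverse (slice f i (suc k)) ≡ f (i + k) ∷ reverse (slice f i k)
reverse-slice-suc f i k =
  trans (cong reverse (slice-∷ʳ f i k)) (reverse-++ (slice f i k) (f (i + k) ∷ []))

length-slice : ∀ (f : InfWord) i k → length (slice f i k) ≡ k
length-slice f i zero    = refl
length-slice f i (suc k) = cong suc (length-slice f (suc i) k)

slice-factor : ∀ (ω : InfWord) i k → Factor (slice ω i k) ω
slice-factor ω i k = i , cong (slice ω i) (length-slice ω i k)

-- The window of length k at i in f is the reversal of the window of length k at j in g.
Mirror : InfWord → ℕ → InfWord → ℕ → ℕ → Set
Mirror f i g j k = ∀ t u → suc (t + u) ≡ k → f (i + t) ≡ g (j + u)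

mirror⇒slice≡reverse-slice : ∀ (f g : InfWord) i j k →
                             Mirror f i g j k → slice f i k ≡ reverse (slice g j k)
mirror⇒slice≡reverse-slice f g i j zero    m = refl
mirror⇒slice≡reverse-slice f g i j (suc k) m =
  trans (cong₂ _∷_ head-eq tail-eq) (sym (reverse-slice-suc g j k))
  where
  head-eq : f i ≡ g (j + k)
  head-eq = trans (cong f (sym (+-identityʳ i))) (m 0 k refl)
  tail-eq : slice f (suc i) k ≡ reverse (slice g j k)
  tail-eq = mirror⇒slice≡reverse-slice f g (suc i) j k
    λ t u e → trans (cong f (sym (+-suc i t))) (m (suc t) u (cong suc e))

slice≡reverse-slice⇒mirror : ∀ (f g : InfWord) i j k →
                             slice f i k ≡ reverse (slice g j k) → Mirror f i g j k
slice≡reverse-slice⇒mirror f g i j (suc k) eq t u e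
  with ∷-injective (trans eq (reverse-slice-suc g j k))
slice≡reverse-slice⇒mirror f g i j (suc k) eq zero u e | head-eq , _ =
  trans (cong f (+-identityʳ i)) (trans head-eq (cong (λ v → g (j + v)) (sym (suc-injective e))))
slice≡reverse-slice⇒mirror f g i j (suc k) eq (suc t) u e | _ , tail-eq =
  trans (cong f (+-suc i t))
        (slice≡reverse-slice⇒mirror f g (suc i) j k tail-eq t u (suc-injective e))

self-mirror⇒palindrome : ∀ (ω : InfWord) i k → Mirror ω i ω i k → Palindrome (slice ω i k)
self-mirror⇒palindrome ω i k m = sym (mirror⇒slice≡reverse-slice ω ω i i k m)

closed⇒mirror : ∀ {ω} → Cl ω → ∀ j k → ∃[ i ] Mirror ω i ω j k
closed⇒mirror {ω} cl j k with cl (slice ω j k) (slice-factor ω j k)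
... | i , eq = i , slice≡reverse-slice⇒mirror ω ω i j k
  (trans (cong (slice ω i) (sym (trans (length-reverse (slice ω j k)) (length-slice ω j k)))) eq)

module Periodic {ω : InfWord} {p N : ℕ} (periodic : ∀ i → N ≤ i → ω (i + p) ≡ ω i) where

  periodic-shift : ∀ q x → N ≤ x → ω (x + q * p) ≡ ω x
  periodic-shift zero    x N≤x = cong ω (+-identityʳ x)
  periodic-shift (suc q) x N≤x = begin
    ω (x + (p + q * p)) ≡⟨ cong ω (rearrange x (q * p) p) ⟩
    ω (x + q * p + p)   ≡⟨ periodic (x + q * p) (≤-trans N≤x (m≤m+n x (q * p))) ⟩
    ω (x + q * p)       ≡⟨ periodic-shift q x N≤x ⟩
    ω x                 ∎
    where
    open ≡-Reasoning
    rearrange : ∀ x y z → x + (z + y) ≡ x + y + z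
    rearrange = solve-∀

  -- Translating the mirrored copy at r + q p back by q periods makes it overlap the
  -- original window at N + r, so that overlap is mirrored onto itself.
  periodic-mirror⇒self-mirror : ∀ r q k →
    Mirror ω (r + q * p) ω N (N + r + k) → Mirror ω (N + r) ω (N + r) k
  periodic-mirror⇒self-mirror r q k m t u e = begin
    ω (N + r + t)               ≡⟨ sym (periodic-shift q (N + r + t) (≤-trans (m≤m+n N r) (m≤m+n (N + r) t))) ⟩
    ω (N + r + t + q * p)       ≡⟨ cong ω (rearrange-left N r t (q * p)) ⟩
    ω (r + q * p + (N + t))     ≡⟨ m (N + t) (r + u) (trans (rearrange-length N r t u) (cong (N + r +_) e)) ⟩
    ω (N + (r + u))             ≡⟨ cong ω (rearrange-right N r u) ⟩
    ω (N + r + u)               ∎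
    where
    open ≡-Reasoning
    rearrange-left : ∀ n r t s → n + r + t + s ≡ r + s + (n + t)
    rearrange-left = solve-∀
    rearrange-length : ∀ n r t u → suc (n + t + (r + u)) ≡ n + r + suc (t + u)
    rearrange-length = solve-∀
    rearrange-right : ∀ n r u → n + (r + u) ≡ n + r + u
    rearrange-right = solve-∀

  closed⇒long-palindrome : Cl ω → .{{NonZero p}} → ∀ K → ∃[ w ] (K ≤ length w × PAL ω w)
  closed⇒long-palindrome cl K with closed⇒mirror cl N (N + p + K)
  ... | i , reversed-occurrence =
    slice ω (N + r) k
    , subst (K ≤_) (sym (length-slice ω (N + r) k)) (m≤n+m K (p ∸ r))
    , slice-factor ω (N + r) k
    , self-mirror⇒palindrome ω (N + r) k (periodic-mirror⇒self-mirror r q k mirror)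
    where
    r q k : ℕ
    r = i % p
    q = i / p
    k = (p ∸ r) + K
    window-end : N + r + k ≡ N + p + K
    window-end = trans (reassociate N r (p ∸ r) K)
                       (cong (λ s → N + s + K) (m+[n∸m]≡n (<⇒≤ (m%n<n i p))))
      where
      reassociate : ∀ n r d k → n + r + (d + k) ≡ n + (r + d) + k
      reassociate = solve-∀
    mirror : Mirror ω (r + q * p) ω N (N + r + k)
    mirror = subst₂ (λ x y → Mirror ω x ω N y) (m≡m%n+[m/n]*n i p) (sym window-end)
                    reversed-occurrence

palindrome-length-bound : ∀ {ω n} → PalCountLe ω n → ∃[ B ] (∀ w → PAL ω w → length w ≤ B)
palindrome-length-bound (L , _ , complete) =
  max 0 (map length L) , λ w pal → All.lookup (xs≤max 0 (map length L)) (∈-map⁺ length (complete w pal))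

closed∧finite-palindromes⇒aperiodic : ∀ {ω n} → Cl ω → PalCountLe ω n → Aperiodic ω
closed∧finite-palindromes⇒aperiodic cl count (p , p>0 , N , periodic)
  with palindrome-length-bound count
... | B , bounded with Periodic.closed⇒long-palindrome periodic cl {{>-nonZero p>0}} (suc B)
... | w , B<|w| , pal = <⇒≱ B<|w| (bounded w pal)

mainTheorem12 : (n : ℕ) → MinPalLe Cl n ⇔ MinPalLe AbCl n
mainTheorem12 n = mk⇔
  (λ (ω , cl , count) → ω , (closed∧finite-palindromes⇒aperiodic cl count , cl) , count)
  (λ (ω , (_ , cl) , count) → ω , cl , count)
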